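{- Let $U$ be a countably infinite set and $\mathrm{G}$ a subgroup of $\mathfrak{S}(U)$. Then the map $\mathfrak{rc}:\mathcal{P}(U)\to\mathcal{P}(U)$, $S\mapsto\mathfrak{rc}(S)$, is an algebraic closure operator (i.e. it is extensive, monotone, idempotent, and $\mathfrak{rc}(S)$ is the union of $\mathfrak{rc}(F)$ over finite $F\subseteq S$).
   Context: For $F\subseteq U$, $\mathrm{G}\langle F\rangle=\{g\in\mathrm{G}\mid g(x)=x\ \forall x\in F\}$. A type is a pair $\langle F\mid p\rangle$ with $F$ a finite subset of $U$ and $p\in U$, with typeset $\mathrm{G}\langle F\mid p\rangle=\{g(p)\mid g\in\mathrm{G}\langle F\rangle\}$; $\mathfrak{R}_0$ is the set of types with finite typeset; $\langle F\mid p\rangle\in\mathfrak{R}_\alpha$ if there is a finite $F'\supseteq F$ such that for every $q\in\mathrm{G}\langle F\mid p\rangle$, $\langle F'\mid q\rangle\in\mathfrak{R}_\beta$ for some $\beta<\alpha$; a type is ranked if it lies in some $\mathfrak{R}_\alpha$. For finite $F$, $\mathfrak{rc}(F)$ is $F$ together with the union of the typesets of ranked types $\langle F\mid p\rangle$; for arbitrary $S$, $\mathfrak{rc}(S)=\bigcup\{\mathfrak{rc}(F)\mid F\text{ a finite subset of } S\}$. -}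

module Defs where

open import Data.Nat using (ℕ)
open import Data.List using (List)
open import Data.List.Membership.Propositional using (_∈_)
open import Data.List.Relation.Unary.All using (All)
open import Data.Product using (Σ; _×_; ∃; ∃-syntax; _,_)
open import Data.Sum using (_⊎_)
open import Function.Bundles using (_↔_; Inverse)
open import Function.Construct.Identity using (↔-id)
open import Function.Construct.Composition using (_↔-∘_)
open import Function.Construct.Symmetry using (↔-sym)
open import Relation.Binary.PropositionalEquality using (_≡_)

Subset : Set → Set₁
Subset U = U → Set

_⊆_ : {U : Set} → Subset U → Subset U → Set
S ⊆ T = ∀ x → S x → T x

_≐_ : {U : Set} → Subset U → Subset U → Set
S ≐ T = (S ⊆ T) × (T ⊆ S)

⟦_⟧ : {U : Set} → List U → Subset U
⟦ F ⟧ x = x ∈ F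

IsFinite : {U : Set} → Subset U → Set
IsFinite {U} A = Σ (List U) λ L → A ⊆ ⟦ L ⟧

Perm : Set → Set
Perm U = U ↔ U

app : {U : Set} → Perm U → U → U
app σ = Inverse.to σ

-- G is a subgroup of S(U), G given as a predicate on permutations
-- (membership respects extensional equality of permutations)
record IsSubgroup {U : Set} (G : Perm U → Set) : Set where
  field
    resp : ∀ σ τ → (∀ x → app σ x ≡ app τ x) → G σ → G τ
    id∈  : G (↔-id U)
    ∘∈   : ∀ σ τ → G σ → G τ → G (σ ↔-∘ τ)
    inv∈ : ∀ σ → G σ → G (↔-sym σ)

module _ {U : Set} (G : Perm U → Set) where

  Stab : List U → Perm U → Set
  Stab F g = G g × (∀ x → x ∈ F → app g x ≡ x)

  TypeSet : List U → U → Subset U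
  TypeSet F p y = Σ (Perm U) λ g → Stab F g × (app g p ≡ y)

  -- Ranked types: the union of the hierarchy R_α over all ordinals α,
  -- given as the least predicate closed under the defining clauses:
  --  * R_0 : the typeset is finite;
  --  * R_α : there is a finite F' ⊇ F with ⟨F' | q⟩ in some earlier R_β
  --          for every q in the typeset of ⟨F | p⟩.
  data Ranked (F : List U) (p : U) : Set where
    rank0 : IsFinite (TypeSet F p) → Ranked F p
    rankS : (F' : List U) → ⟦ F ⟧ ⊆ ⟦ F' ⟧ →
            (∀ q → TypeSet F p q → Ranked F' q) → Ranked F p

  rcFin : List U → Subset U
  rcFin F x = (x ∈ F) ⊎ (Σ U λ p → Ranked F p × TypeSet F p x)

  rc : Subset U → Subset U
  rc S x = Σ (List U) λ F → All S F × rcFin F x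

  IsAlgebraicClosureOperator : Set₁
  IsAlgebraicClosureOperator =
      (∀ S → S ⊆ rc S)
    × (∀ S T → S ⊆ T → rc S ⊆ rc T)
    × (∀ S → rc (rc S) ≐ rc S)
    × (∀ S → rc S ≐ (λ x → Σ (List U) λ F → All S F × rc ⟦ F ⟧ x))

module Submission where

open import Defs
open import Data.Nat using (ℕ)
open import Function.Bundles using (_↔_; Inverse)
open import Function.Construct.Identity using (↔-id)
open import Function.Construct.Composition using (_↔-∘_)
open import Function.Construct.Symmetry using (↔-sym)
open import Data.List using (List; []; _∷_; _++_; map)
open import Data.List.Membership.Propositional using (_∈_)
open import Data.List.Membership.Propositional.Properties using (∈-++⁺ˡ; ∈-++⁺ʳ; ∈-map⁺)
open import Data.List.Relation.Unary.All as All using (All; []; _∷_)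
open import Data.List.Relation.Unary.All.Properties using (++⁺)
open import Data.List.Relation.Unary.Any using (here; there)
open import Data.Product using (Σ; _×_; _,_)
open import Data.Sum using (_⊎_; inj₁; inj₂)
open import Relation.Binary.PropositionalEquality using (_≡_; refl; sym; trans; cong; subst)

-- Ranked types are invariant under G and under enlarging the parameter set.
-- The heart of the matter is a cut rule: if ⟨H | y⟩ and ⟨y ∷ H | x⟩ are both
-- ranked, so is ⟨H | x⟩.  It is proved by induction on the rank of ⟨H | y⟩:
-- every q = g(x) with g ∈ G⟨H⟩ is ranked over {g(y)} ∪ F', and g(y) is of lower
-- rank over F'.  Iterating the cut absorbs any finite set of elements of rc(H)
-- into H, which gives idempotence; the other axioms are bookkeeping.

module _ {U : Set} {G : Perm U → Set} (G-subgroup : IsSubgroup G) where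
  open IsSubgroup G-subgroup

  _MapsInto_ : Perm U → List U → List U → Set
  (g MapsInto F) F* = ∀ x → x ∈ F → app g x ∈ F*

  Stab-id : (F : List U) → Stab G F (↔-id U)
  Stab-id F = id∈ , λ _ _ → refl

  TypeSet-refl : (F : List U) (x : U) → TypeSet G F x x
  TypeSet-refl F x = ↔-id U , Stab-id F , refl

  TypeSet-trans : ∀ F {p q r} → TypeSet G F p q → TypeSet G F q r → TypeSet G F p r
  TypeSet-trans F (g , (g∈G , g-fix) , gp≡q) (k , (k∈G , k-fix) , kq≡r) =
    (k ↔-∘ g) ,
    (∘∈ _ _ k∈G g∈G , λ x x∈F → trans (cong (app k) (g-fix x x∈F)) (k-fix x x∈F)) ,
    trans (cong (app k) gp≡q) kq≡r

  -- If q = k(g p) with k fixing F* ⊇ g(F), then g⁻¹ k g fixes F and sends p to g⁻¹ q.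
  TypeSet-pullback : ∀ {F F* p q} g → G g → (g MapsInto F) F* →
                     TypeSet G F* (app g p) q → TypeSet G F p (app (↔-sym g) q)
  TypeSet-pullback g g∈G g[F]⊆F* (k , (k∈G , k-fix) , kgp≡q) =
    ((↔-sym g ↔-∘ k) ↔-∘ g) ,
    (∘∈ _ _ (∘∈ _ _ (inv∈ g g∈G) k∈G) g∈G ,
     λ x x∈F → trans (cong (app (↔-sym g)) (k-fix (app g x) (g[F]⊆F* x x∈F)))
                     (Inverse.strictlyInverseʳ g x)) ,
    cong (app (↔-sym g)) kgp≡q

  Ranked-map : ∀ {F p} → Ranked G F p → ∀ {F*} g → G g → (g MapsInto F) F* →
               Ranked G F* (app g p)
  Ranked-map (rank0 (L , TS⊆L)) g g∈G g[F]⊆F* =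
    rank0 (map (app g) L , λ q q∈TS →
      subst (_∈ map (app g) L) (Inverse.strictlyInverseˡ g q)
        (∈-map⁺ (app g) (TS⊆L _ (TypeSet-pullback g g∈G g[F]⊆F* q∈TS))))
  Ranked-map (rankS F' F⊆F' ranked') {F*} g g∈G g[F]⊆F* =
    rankS (map (app g) F' ++ F*) (λ _ → ∈-++⁺ʳ (map (app g) F')) λ q q∈TS →
      subst (Ranked G (map (app g) F' ++ F*)) (Inverse.strictlyInverseˡ g q)
        (Ranked-map (ranked' _ (TypeSet-pullback g g∈G g[F]⊆F* q∈TS)) g g∈G
          λ _ x∈F' → ∈-++⁺ˡ (∈-map⁺ (app g) x∈F'))

  Ranked-mono : ∀ {F H p} → ⟦ F ⟧ ⊆ ⟦ H ⟧ → Ranked G F p → Ranked G H p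
  Ranked-mono F⊆H r = Ranked-map r (↔-id U) id∈ F⊆H

  Ranked-TypeSet : ∀ {F p q} → Ranked G F p → TypeSet G F p q → Ranked G F q
  Ranked-TypeSet {F} (rank0 (L , TS⊆L)) p~q =
    rank0 (L , λ r q~r → TS⊆L r (TypeSet-trans F p~q q~r))
  Ranked-TypeSet {F} (rankS F' F⊆F' ranked') p~q =
    rankS F' F⊆F' λ r q~r → ranked' r (TypeSet-trans F p~q q~r)

  Ranked-cut : ∀ {H y x} → Ranked G H y → Ranked G (y ∷ H) x → Ranked G H x
  Ranked-cut {H} (rank0 (L , TS⊆L)) ranked-x =
    rankS (L ++ H) (λ _ → ∈-++⁺ʳ L) λ q (g , (g∈G , g-fix) , gx≡q) →
      subst (Ranked G (L ++ H)) gx≡q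
        (Ranked-map ranked-x g g∈G λ
          { _ (here refl) → ∈-++⁺ˡ (TS⊆L _ (g , (g∈G , g-fix) , refl))
          ; z (there z∈H) → subst (_∈ L ++ H) (sym (g-fix z z∈H)) (∈-++⁺ʳ L z∈H) })
  Ranked-cut {H} {y} {x} (rankS F' H⊆F' ranked') ranked-x =
    rankS F' H⊆F' λ q (g , (g∈G , g-fix) , gx≡q) →
      subst (Ranked G F') gx≡q
        (Ranked-cut (ranked' (app g y) (g , (g∈G , g-fix) , refl))
          (Ranked-map ranked-x g g∈G λ
            { _ (here refl) → here refl
            ; z (there z∈H) → there (subst (_∈ F') (sym (g-fix z z∈H)) (H⊆F' z z∈H)) }))

  rcFin⇒∈⊎Ranked : ∀ {H y} → rcFin G H y → (y ∈ H) ⊎ Ranked G H y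
  rcFin⇒∈⊎Ranked (inj₁ y∈H) = inj₁ y∈H
  rcFin⇒∈⊎Ranked (inj₂ (p , ranked-p , p~y)) = inj₂ (Ranked-TypeSet ranked-p p~y)

  Ranked⇒rcFin : ∀ {H y} → Ranked G H y → rcFin G H y
  Ranked⇒rcFin {H} {y} ranked-y = inj₂ (y , ranked-y , TypeSet-refl H y)

  Ranked-cut* : ∀ {H x} E → All (rcFin G H) E → Ranked G (E ++ H) x → Ranked G H x
  Ranked-cut* [] [] r = r
  Ranked-cut* {H} (y ∷ E) (y∈rc ∷ E⊆rc) r with rcFin⇒∈⊎Ranked y∈rc
  ... | inj₁ y∈H = Ranked-cut* E E⊆rc (Ranked-mono
          (λ { _ (here refl) → ∈-++⁺ʳ E y∈H ; _ (there z∈) → z∈ }) r)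
  ... | inj₂ ranked-y = Ranked-cut* E E⊆rc
          (Ranked-cut (Ranked-mono (λ _ → ∈-++⁺ʳ E) ranked-y) r)

  rcFin-mono : ∀ {F H} → ⟦ F ⟧ ⊆ ⟦ H ⟧ → rcFin G F ⊆ rcFin G H
  rcFin-mono F⊆H x x∈rc with rcFin⇒∈⊎Ranked x∈rc
  ... | inj₁ x∈F = inj₁ (F⊆H x x∈F)
  ... | inj₂ ranked-x = Ranked⇒rcFin (Ranked-mono F⊆H ranked-x)

  rcFin-closed : ∀ {F H} → All (rcFin G H) F → rcFin G F ⊆ rcFin G H
  rcFin-closed {F} F⊆rc x x∈rc with rcFin⇒∈⊎Ranked x∈rc
  ... | inj₁ x∈F = All.lookup F⊆rc x∈F
  ... | inj₂ ranked-x =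
    Ranked⇒rcFin (Ranked-cut* F F⊆rc (Ranked-mono (λ _ → ∈-++⁺ˡ) ranked-x))

  All-rc⇒rcFin : ∀ S F → All (rc G S) F → Σ (List U) λ H → All S H × All (rcFin G H) F
  All-rc⇒rcFin S [] [] = [] , [] , []
  All-rc⇒rcFin S (y ∷ F) ((Fy , Fy⊆S , y∈rc) ∷ F⊆rc) with All-rc⇒rcFin S F F⊆rc
  ... | H , H⊆S , F⊆rcH =
    (Fy ++ H) , ++⁺ Fy⊆S H⊆S ,
    rcFin-mono (λ _ → ∈-++⁺ˡ) y y∈rc ∷ All.map (rcFin-mono (λ _ → ∈-++⁺ʳ Fy) _) F⊆rcH

  rc-extensive : ∀ S → S ⊆ rc G S
  rc-extensive S x x∈S = (x ∷ []) , (x∈S ∷ []) , inj₁ (here refl)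

  rc-mono : ∀ S T → S ⊆ T → rc G S ⊆ rc G T
  rc-mono S T S⊆T x (F , F⊆S , x∈rc) = F , All.map (S⊆T _) F⊆S , x∈rc

  rc-idempotent : ∀ S → rc G (rc G S) ≐ rc G S
  rc-idempotent S =
    (λ x (F , F⊆rc , x∈rc) → let H , H⊆S , F⊆rcH = All-rc⇒rcFin S F F⊆rc in
                              H , H⊆S , rcFin-closed F⊆rcH x x∈rc) ,
    rc-extensive (rc G S)

  rc-algebraic : ∀ S → rc G S ≐ (λ x → Σ (List U) λ F → All S F × rc G ⟦ F ⟧ x)
  rc-algebraic S =
    (λ x (F , F⊆S , x∈rc) → F , F⊆S , F , All.tabulate (λ y∈F → y∈F) , x∈rc) ,
    (λ x (F , F⊆S , F' , F'⊆F , x∈rc) → F' , All.map (All.lookup F⊆S) F'⊆F , x∈rc)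

lemma7p13 : (U : Set) → U ↔ ℕ → (G : Perm U → Set) → IsSubgroup G →
    IsAlgebraicClosureOperator G
lemma7p13 U _ G G-subgroup =
  rc-extensive G-subgroup , rc-mono G-subgroup ,
  rc-idempotent G-subgroup , rc-algebraic G-subgroup
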